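{- Let $G$ be a loopless multigraph of maximum degree $\Delta\ge 2$. For every proper partial $\lfloor 3\Delta/2\rfloor$-edge-coloring $\phi$ of $G$ and every uncolored edge $e$, there is a connected $e$-augmenting subgraph $H\subseteq G$.
   Context: A partial $r$-edge-coloring is a map $\phi:E(G)\to\{1,\dots,r\}\cup\{\mathsf{blank}\}$; edges mapped to $\mathsf{blank}$ are uncolored, and $\mathsf{dom}(\phi)$ is the set of colored edges. It is proper if any two distinct colored edges sharing an endpoint receive distinct colors. For a set $S$ of uncolored edges, a subgraph $H\subseteq G$ is $S$-augmenting (with respect to $\phi$) if there is a proper partial coloring $\phi'$ with $\mathsf{dom}(\phi')=\mathsf{dom}(\phi)\cup S$ and $\phi'(f)=\phi(f)$ for all $f\notin E(H)$; for $S=\{e\}$ we say $e$-augmenting. -}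

module Defs where

open import Data.Nat using (ℕ; _≤_; _*_; _/_)
open import Data.Fin using (Fin)
open import Data.Bool using (Bool; true; false; T)
open import Data.Maybe using (Maybe; just; nothing; Is-just)
open import Data.List using (List; length; filter; allFin)
open import Data.Product using (Σ; _×_; _,_; proj₁; proj₂; ∃; ∃-syntax)
open import Data.Sum using (_⊎_)
open import Relation.Nullary using (¬_; Dec; yes; no)
open import Relation.Binary.PropositionalEquality using (_≡_; _≢_)
open import Data.Fin using (_≟_)
open import Function.Bundles using (_⇔_)

record Multigraph : Set where
  field
    n   : ℕ
    m   : ℕ
    end : Fin m → Fin n × Fin n

open Multigraph public

Loopless : Multigraph → Set
Loopless G = ∀ f → proj₁ (end G f) ≢ proj₂ (end G f)

Incident : (G : Multigraph) → Fin (m G) → Fin (n G) → Set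
Incident G f v = (proj₁ (end G f) ≡ v) ⊎ (proj₂ (end G f) ≡ v)

incident? : (G : Multigraph) → (v : Fin (n G)) → (f : Fin (m G)) → Dec (Incident G f v)
incident? G v f with proj₁ (end G f) ≟ v | proj₂ (end G f) ≟ v
... | yes p | _ = yes (Data.Sum.inj₁ p)
... | no _ | yes q = yes (Data.Sum.inj₂ q)
... | no p | no q = no λ { (Data.Sum.inj₁ x) → p x ; (Data.Sum.inj₂ y) → q y }

-- degree: number of edges incident to v (for loopless multigraphs this
-- is the usual degree)
deg : (G : Multigraph) → Fin (n G) → ℕ
deg G v = length (filter (incident? G v) (allFin (m G)))

MaxDegree : Multigraph → ℕ → Set
MaxDegree G Δ = (∀ v → deg G v ≤ Δ) × (∃[ v ] deg G v ≡ Δ)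

-- partial r-edge-coloring: nothing = blank
PartialColoring : Multigraph → ℕ → Set
PartialColoring G r = Fin (m G) → Maybe (Fin r)

ShareEnd : (G : Multigraph) → Fin (m G) → Fin (m G) → Set
ShareEnd G f g = ∃[ v ] (Incident G f v × Incident G g v)

Proper : (G : Multigraph) (r : ℕ) → PartialColoring G r → Set
Proper G r φ = ∀ f g → f ≢ g → ShareEnd G f g → ∀ c → φ f ≡ just c → φ g ≡ just c → Data.Empty.⊥
  where import Data.Empty

record Subgraph (G : Multigraph) : Set where
  field
    V : Fin (n G) → Bool
    E : Fin (m G) → Bool
    closed : ∀ f → T (E f) → T (V (proj₁ (end G f))) × T (V (proj₂ (end G f)))

open Subgraph public

data Reach (G : Multigraph) (H : Subgraph G) : Fin (n G) → Fin (n G) → Set where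
  here : ∀ {u} → Reach G H u u
  step : ∀ {u w v} (f : Fin (m G)) → T (E H f) →
         ((end G f ≡ (u , w)) ⊎ (end G f ≡ (w , u))) →
         Reach G H w v → Reach G H u v

Connected : (G : Multigraph) → Subgraph G → Set
Connected G H = (∃[ v ] T (V H v)) ×
  (∀ u v → T (V H u) → T (V H v) → Reach G H u v)

-- H is S-augmenting w.r.t. φ (S given as a predicate on edges, assumed uncolored)
Augmenting : (G : Multigraph) (r : ℕ) (φ : PartialColoring G r)
             (S : Fin (m G) → Set) (H : Subgraph G) → Set
Augmenting G r φ S H = Σ (PartialColoring G r) λ φ' →
  Proper G r φ' ×
  (∀ f → (Is-just (φ' f) ⇔ (Is-just (φ f) ⊎ S f))) ×
  (∀ f → ¬ T (E H f) → φ' f ≡ φ f)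

EAugmenting : (G : Multigraph) (r : ℕ) (φ : PartialColoring G r)
              (e : Fin (m G)) (H : Subgraph G) → Set
EAugmenting G r φ e H = Augmenting G r φ (λ f → f ≡ e) H

module Submission where

-- Write e = uv. Since r = ⌊3Δ/2⌋ ≥ Δ, each end of e misses some colour. If u and v miss
-- a common colour, give it to e. Otherwise let α be missing at u and let f = vw be the
-- α-edge at v. If v and w miss a common colour, move f to it and give e the colour α.
-- Otherwise u and w miss a common colour γ, because three vertices with pairwise disjoint
-- sets of missing colours see at least 2r ≥ 3Δ - 1 colours, while u, v, w see at most
-- (Δ - 1) + (Δ - 1) + Δ. Let β be missing at v. If the β/γ Kempe chain from v avoids u,
-- swapping it frees γ at v. Otherwise it ends at u, so the β/γ chain from w cannot reach v
-- (a chain has only two ends); swapping it frees β at w, f moves to β and e gets α.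
-- In every case H consists of e and the recoloured edges, all reachable from u.

open import Defs
open import Data.Nat using (ℕ; _≤_; _*_; _/_)
open import Data.Fin using (Fin)
open import Data.Maybe using (nothing)
open import Data.Product using (_×_; ∃-syntax)
open import Relation.Binary.PropositionalEquality using (_≡_)

open import Data.Nat using (zero; suc; _+_; _%_; _<_; z≤n; s≤s; s≤s⁻¹)
open import Data.Nat.Properties
  using ( ≤-refl; ≤-reflexive; ≤-trans; <-≤-trans; <⇒≱; ≮⇒≥; n<1+n
        ; +-comm; +-assoc; +-suc; +-identityʳ; *-comm; *-identityʳ
        ; +-mono-≤; +-monoˡ-≤; +-monoʳ-≤; +-mono-<-≤; +-mono-≤-<; *-monoˡ-≤
        ; m≤m+n; m≤n+m; +-0-commutativeMonoid )
open import Data.Nat.DivMod using (m≡m%n+[m/n]*n; m%n<n)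
open import Algebra.Properties.CommutativeMonoid.Sum +-0-commutativeMonoid
  using (sum; ∑-distrib-+; ∑-comm)
open import Data.Fin using (zero; suc; _≟_)
import Data.Fin.Properties as Fin
open import Data.Bool using (Bool; true; false; T; not)
open import Data.Bool.Properties using (not-involutive)
open import Data.Maybe using (just; Is-just)
import Data.Maybe as Maybe
import Data.Maybe.Properties as Maybe
open import Data.Maybe.Relation.Unary.Any using () renaming (just to is-just)
open import Data.List using (List; []; _∷_; length; filter; tabulate)
open import Data.List.Membership.Propositional using (_∈_; _∉_)
open import Data.List.Relation.Binary.Subset.Propositional using (_⊆_)
open import Data.List.Relation.Unary.Any using (here; there)
open import Data.Product using (_,_; proj₁; proj₂)
open import Data.Sum using (_⊎_; inj₁; inj₂; [_,_]′)
import Data.Sum as Sum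
open import Data.Unit using (tt)
open import Data.Empty using (⊥-elim)
open import Function using (_∘_; id)
open import Function.Bundles using (_⇔_; mk⇔; Equivalence)
import Function.Properties.Equivalence as ⇔
open import Relation.Nullary using (¬_; Dec; yes; no)
open import Relation.Nullary.Decidable using (⌊_⌋; toWitness; fromWitness; _×-dec_; ¬?; decidable-stable)
open import Relation.Binary.PropositionalEquality
  using (_≢_; refl; sym; trans; cong; subst; subst₂)

-- Finite sums of indicators

𝟙 : ∀ {a} {A : Set a} → Dec A → ℕ
𝟙 (yes _) = 1
𝟙 (no _)  = 0

𝟙-yes : ∀ {a} {A : Set a} (a? : Dec A) → A → 𝟙 a? ≡ 1
𝟙-yes (yes _) _ = refl
𝟙-yes (no ¬a) a = ⊥-elim (¬a a)

𝟙-no : ∀ {a} {A : Set a} (a? : Dec A) → ¬ A → 𝟙 a? ≡ 0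
𝟙-no (yes a) ¬a = ⊥-elim (¬a a)
𝟙-no (no _)  _  = refl

𝟙-mono : ∀ {a b} {A : Set a} {B : Set b} (a? : Dec A) (b? : Dec B) → (A → B) → 𝟙 a? ≤ 𝟙 b?
𝟙-mono (yes a) (yes _) _   = ≤-refl
𝟙-mono (yes a) (no ¬b) a→b = ⊥-elim (¬b (a→b a))
𝟙-mono (no _)  _       _   = z≤n

sum-mono-≤ : ∀ {n} {f g : Fin n → ℕ} → (∀ i → f i ≤ g i) → sum f ≤ sum g
sum-mono-≤ {zero}  f≤g = z≤n
sum-mono-≤ {suc n} f≤g = +-mono-≤ (f≤g zero) (sum-mono-≤ (f≤g ∘ suc))

sum-mono-< : ∀ {n} {f g : Fin n → ℕ} → (∀ i → f i ≤ g i) → ∀ j → f j < g j → sum f < sum g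
sum-mono-< f≤g zero    fj<gj = +-mono-<-≤ fj<gj (sum-mono-≤ (f≤g ∘ suc))
sum-mono-< f≤g (suc j) fj<gj = +-mono-≤-< (f≤g zero) (sum-mono-< (f≤g ∘ suc) j fj<gj)

term≤sum : ∀ {n} (f : Fin n → ℕ) j → f j ≤ sum f
term≤sum f zero    = m≤m+n _ _
term≤sum f (suc j) = ≤-trans (term≤sum (f ∘ suc) j) (m≤n+m _ _)

sum-zero : ∀ {n} {f : Fin n → ℕ} → (∀ i → f i ≡ 0) → sum f ≡ 0
sum-zero {zero}  f≡0 = refl
sum-zero {suc n} f≡0 rewrite f≡0 zero = sum-zero (f≡0 ∘ suc)

sum-const : ∀ n k → sum {n} (λ _ → k) ≡ n * k
sum-const zero    k = refl
sum-const (suc n) k = cong (k +_) (sum-const n k)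

∑𝟙-atMostOne : ∀ {n p} {P : Fin n → Set p} (P? : ∀ i → Dec (P i)) →
               (∀ i j → P i → P j → i ≡ j) → sum (λ i → 𝟙 (P? i)) ≤ 1
∑𝟙-atMostOne {zero}  P? unique = z≤n
∑𝟙-atMostOne {suc n} P? unique with P? zero
... | yes p₀ = s≤s (≤-reflexive (sum-zero λ i → 𝟙-no (P? (suc i)) λ pᵢ → zero≢suc (unique zero (suc i) p₀ pᵢ)))
  where
  zero≢suc : ∀ {i : Fin n} → Fin.zero ≢ suc i
  zero≢suc ()
... | no _   = ∑𝟙-atMostOne (P? ∘ suc) λ i j pᵢ pⱼ → Fin.suc-injective (unique (suc i) (suc j) pᵢ pⱼ)

length-filter-tabulate : ∀ {n p} {A : Set} {P : A → Set p} (P? : ∀ a → Dec (P a)) (g : Fin n → A) →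
                         length (filter P? (tabulate g)) ≡ sum (λ i → 𝟙 (P? (g i)))
length-filter-tabulate {zero}  P? g = refl
length-filter-tabulate {suc n} P? g with P? (g zero)
... | yes _ = cong suc (length-filter-tabulate P? (g ∘ suc))
... | no _  = length-filter-tabulate P? (g ∘ suc)

module _ {G : Multigraph} {H : Subgraph G} where

  Reach-snoc : ∀ {u w v} → Reach G H u w → (f : Fin (m G)) → T (E H f) →
               (end G f ≡ (w , v)) ⊎ (end G f ≡ (v , w)) → Reach G H u v
  Reach-snoc here               f f∈H f-wv = step f f∈H f-wv here
  Reach-snoc (step g g∈H g-uw p) f f∈H f-wv = step g g∈H g-uw (Reach-snoc p f f∈H f-wv)

  Reach-sym : ∀ {u v} → Reach G H u v → Reach G H v u
  Reach-sym here               = here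
  Reach-sym (step f f∈H f-uw p) = Reach-snoc (Reach-sym p) f f∈H (Sum.swap f-uw)

  Reach-trans : ∀ {u v w} → Reach G H u v → Reach G H v w → Reach G H u w
  Reach-trans here               q = q
  Reach-trans (step f f∈H f-uw p) q = step f f∈H f-uw (Reach-trans p q)

module Edges (G : Multigraph) where

  Edge : Set
  Edge = Fin (m G)

  Vertex : Set
  Vertex = Fin (n G)

  end₁ end₂ : Edge → Vertex
  end₁ f = proj₁ (end G f)
  end₂ f = proj₂ (end G f)

  open import Data.List.Membership.DecPropositional (_≟_ {m G}) using (_∈?_) public

  spannedBy : List Edge → Subgraph G
  V (spannedBy L) z = ⌊ Fin.any? (λ f → (f ∈? L) ×-dec incident? G z f) ⌋
  E (spannedBy L) f = ⌊ f ∈? L ⌋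
  closed (spannedBy L) f f∈L = fromWitness (f , toWitness f∈L , inj₁ refl) , fromWitness (f , toWitness f∈L , inj₂ refl)

  ∈⇒spanned : ∀ {L f} → f ∈ L → T (E (spannedBy L) f)
  ∈⇒spanned = fromWitness

  spannedBy-connected : ∀ {L e} → e ∈ L → (∀ {f} → f ∈ L → Reach G (spannedBy L) (end₁ e) (end₁ f)) →
                        Connected G (spannedBy L)
  spannedBy-connected {L} {e} e∈L reach =
    (end₁ e , fromWitness (e , e∈L , inj₁ refl)) , λ a b a∈H b∈H → Reach-trans (Reach-sym (from-e a a∈H)) (from-e b b∈H)
    where
    from-e : ∀ z → T (V (spannedBy L) z) → Reach G (spannedBy L) (end₁ e) z
    from-e z z∈H with toWitness z∈H
    ... | f , f∈L , inj₁ refl = reach f∈L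
    ... | f , f∈L , inj₂ refl = Reach-snoc (reach f∈L) f (∈⇒spanned f∈L) (inj₁ refl)

  record OtherEnd (g : Edge) (y : Vertex) : Set where
    field
      vertex   : Vertex
      joins    : (end G g ≡ (y , vertex)) ⊎ (end G g ≡ (vertex , y))
      incident : Incident G g vertex
      distinct : vertex ≢ y
      only     : ∀ z → Incident G g z → z ≡ y ⊎ z ≡ vertex

  otherEnd : Loopless G → ∀ g y → Incident G g y → OtherEnd g y
  otherEnd loopless g y (inj₁ refl) = record
    { vertex = end₂ g ; joins = inj₁ refl ; incident = inj₂ refl ; distinct = loopless g ∘ sym
    ; only = λ { z (inj₁ refl) → inj₁ refl ; z (inj₂ refl) → inj₂ refl } }
  otherEnd loopless g y (inj₂ refl) = record
    { vertex = end₁ g ; joins = inj₂ refl ; incident = inj₁ refl ; distinct = loopless g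
    ; only = λ { z (inj₁ refl) → inj₂ refl ; z (inj₂ refl) → inj₁ refl } }

module Colourings (G : Multigraph) (r : ℕ) where
  open Edges G

  Colouring : Set
  Colouring = PartialColoring G r

  Present : Colouring → Vertex → Fin r → Set
  Present ψ z c = ∃[ g ] (Incident G g z × ψ g ≡ just c)

  Missing : Colouring → Vertex → Fin r → Set
  Missing ψ z c = ¬ Present ψ z c

  present? : ∀ ψ z c → Dec (Present ψ z c)
  present? ψ z c = Fin.any? (λ g → incident? G z g ×-dec Maybe.≡-dec _≟_ (ψ g) (just c))

  missing? : ∀ ψ z c → Dec (Missing ψ z c)
  missing? ψ z c = ¬? (present? ψ z c)

  ¬missing⇒present : ∀ {ψ z c} → ¬ Missing ψ z c → Present ψ z c
  ¬missing⇒present = decidable-stable (present? _ _ _)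

  CommonMissing : Colouring → Vertex → Vertex → Set
  CommonMissing ψ a b = ∃[ c ] (Missing ψ a c × Missing ψ b c)

  commonMissing? : ∀ ψ a b → Dec (CommonMissing ψ a b)
  commonMissing? ψ a b = Fin.any? (λ c → missing? ψ a c ×-dec missing? ψ b c)

  just-injective : ∀ {a b : Fin r} → just a ≡ just b → a ≡ b
  just-injective refl = refl

  proper⇒unique : ∀ {ψ} → Proper G r ψ → ∀ {g f z c} → Incident G g z → Incident G f z →
                  ψ g ≡ just c → ψ f ≡ just c → g ≡ f
  proper⇒unique proper {g} {f} {z} {c} g∼z f∼z g-c f-c with g ≟ f
  ... | yes g≡f = g≡f
  ... | no g≢f  = ⊥-elim (proper g f g≢f (z , g∼z , f∼z) c g-c f-c)

  recolour : Colouring → Edge → Fin r → Colouring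
  recolour ψ f c g with g ≟ f
  ... | yes _ = just c
  ... | no _  = ψ g

  recolour-≡ : ∀ ψ f c → recolour ψ f c f ≡ just c
  recolour-≡ ψ f c with f ≟ f
  ... | yes _  = refl
  ... | no f≢f = ⊥-elim (f≢f refl)

  recolour-≢ : ∀ ψ f c g → g ≢ f → recolour ψ f c g ≡ ψ g
  recolour-≢ ψ f c g g≢f with g ≟ f
  ... | yes g≡f = ⊥-elim (g≢f g≡f)
  ... | no _    = refl

  missing-at-ends : ∀ {ψ f c} → Missing ψ (end₁ f) c → Missing ψ (end₂ f) c → ∀ {z} → Incident G f z → Missing ψ z c
  missing-at-ends c∉end₁ c∉end₂ (inj₁ refl) = c∉end₁
  missing-at-ends c∉end₁ c∉end₂ (inj₂ refl) = c∉end₂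

  recolour-proper : ∀ {ψ} → Proper G r ψ → ∀ f c → (∀ {z} → Incident G f z → Missing ψ z c) →
                    Proper G r (recolour ψ f c)
  recolour-proper {ψ} proper f c c∉f g h g≢h (z , g∼z , h∼z) d g-d h-d with g ≟ f | h ≟ f
  ... | yes refl | yes refl = g≢h refl
  ... | yes refl | no _     = c∉f g∼z (h , h∼z , trans h-d (cong just (sym (just-injective g-d))))
  ... | no _     | yes refl = c∉f h∼z (g , g∼z , trans g-d (cong just (sym (just-injective h-d))))
  ... | no _     | no _     = proper g h g≢h (z , g∼z , h∼z) d g-d h-d

  recolour-missing : ∀ {ψ z d} f c → Missing ψ z d → (Incident G f z → c ≢ d) → Missing (recolour ψ f c) z d
  recolour-missing {ψ} f c d∉z c≢d (g , g∼z , g-d) with g ≟ f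
  ... | yes refl = c≢d g∼z (just-injective g-d)
  ... | no _     = d∉z (g , g∼z , g-d)

  recolour-frees : ∀ {ψ z d} f c → (∀ g → Incident G g z → ψ g ≡ just d → g ≡ f) → c ≢ d →
                   Missing (recolour ψ f c) z d
  recolour-frees {ψ} f c only-f c≢d (g , g∼z , g-d) with g ≟ f
  ... | yes refl = c≢d (just-injective g-d)
  ... | no g≢f   = g≢f (only-f g g∼z g-d)

  SameDomain : Colouring → Colouring → Set
  SameDomain ψ ψ′ = ∀ g → Is-just (ψ g) ⇔ Is-just (ψ′ g)

  recolour-sameDomain : ∀ ψ f c → Is-just (ψ f) → SameDomain ψ (recolour ψ f c)
  recolour-sameDomain ψ f c f-coloured g with g ≟ f
  ... | yes refl = mk⇔ (λ _ → is-just tt) (λ _ → f-coloured)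
  ... | no _     = ⇔.refl

  recolour-extends : ∀ φ ψ e c → SameDomain φ ψ → ∀ f → Is-just (recolour ψ e c f) ⇔ (Is-just (φ f) ⊎ f ≡ e)
  recolour-extends φ ψ e c same f with f ≟ e
  ... | yes f≡e = mk⇔ (λ _ → inj₂ f≡e) (λ _ → is-just tt)
  ... | no f≢e  = mk⇔ (inj₁ ∘ Equivalence.from (same f)) [ Equivalence.to (same f) , ⊥-elim ∘ f≢e ]′

-- Kempe chains

module KempeChains (G : Multigraph) (r : ℕ) (loopless : Loopless G) (φ : PartialColoring G r)
                   (proper : Proper G r φ) (β γ : Fin r) (β≢γ : β ≢ γ) where
  open Edges G
  open Colourings G r

  -- Walking along a chain alternates between the two colours, so they are indexed by Bool.
  colour : Bool → Fin r
  colour true  = β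
  colour false = γ

  colour-not : ∀ b → colour b ≢ colour (not b)
  colour-not true  = β≢γ
  colour-not false = β≢γ ∘ sym

  colour-not-injective : ∀ b b′ → colour (not b) ≡ colour (not b′) → colour b ≡ colour b′
  colour-not-injective true  true  _ = refl
  colour-not-injective false false _ = refl
  colour-not-injective true  false γ≡β = ⊥-elim (β≢γ (sym γ≡β))
  colour-not-injective false true  β≡γ = ⊥-elim (β≢γ β≡γ)

  Bichromatic : Edge → Set
  Bichromatic g = φ g ≡ just β ⊎ φ g ≡ just γ

  bichromatic-split : ∀ {h} b → Bichromatic h → φ h ≡ just (colour b) ⊎ φ h ≡ just (colour (not b))
  bichromatic-split true  = id
  bichromatic-split false = Sum.swap

  colour⇒bichromatic : ∀ {h} b → φ h ≡ just (colour b) → Bichromatic h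
  colour⇒bichromatic true  = inj₁
  colour⇒bichromatic false = inj₂

  present-both : ∀ {z} b → Present φ z (colour b) → Present φ z (colour (not b)) → Present φ z β × Present φ z γ
  present-both true  p q = p , q
  present-both false p q = q , p

  Closed : List Edge → Set
  Closed L = ∀ z {f g} → f ∈ L → Incident G f z → Incident G g z → Bichromatic g → g ∈ L

  Touches : List Edge → Vertex → Set
  Touches L z = ∃[ f ] (f ∈ L × Incident G f z)

  touches? : ∀ L z → Dec (Touches L z)
  touches? L z = Fin.any? (λ f → (f ∈? L) ×-dec incident? G z f)

  unvisited : List Edge → ℕ
  unvisited L = sum (λ f → 𝟙 (¬? (f ∈? L)))

  unvisited-∷ : ∀ {g L} → g ∉ L → unvisited (g ∷ L) < unvisited L
  unvisited-∷ {g} {L} g∉L =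
    sum-mono-< (λ f → 𝟙-mono (¬? (f ∈? (g ∷ L))) (¬? (f ∈? L)) (λ f∉g∷L f∈L → f∉g∷L (there f∈L))) g
      (subst₂ _<_ (sym (𝟙-no (¬? (g ∈? (g ∷ L))) (λ g∉g∷L → g∉g∷L (here refl)))) (sym (𝟙-yes (¬? (g ∈? L)) g∉L)) (s≤s z≤n))

  -- Walk L y b: the edges walked so far are L, the walk stands at y, and its next edge has colour b.
  module From (x : Vertex) (b₀ : Bool) (x-missing : Missing φ x (colour (not b₀))) where

    record Walk (L : List Edge) (y : Vertex) (b : Bool) : Set where
      field
        bichromatic  : ∀ {f} → f ∈ L → Bichromatic f
        closed-off-y : ∀ z {f g} → z ≢ y → f ∈ L → Incident G f z → Incident G g z → Bichromatic g → g ∈ L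
        entered      : ∀ h → Incident G h y → φ h ≡ just (colour (not b)) → h ∈ L
        fresh        : ∀ h → Incident G h y → φ h ≡ just (colour b) → h ∉ L
        interior     : ∀ z → Touches L z → z ≢ y → z ≢ x → Present φ z β × Present φ z γ
        entry        : y ≡ x ⊎ ∃[ h ] (h ∈ L × Incident G h y × φ h ≡ just (colour (not b)))
        minimal      : ∀ K → Closed K → Touches K x → L ⊆ K
        reachable    : ∀ Hs → L ⊆ Hs → Reach G (spannedBy Hs) x y × (∀ {f} → f ∈ L → Reach G (spannedBy Hs) x (end₁ f))
        started      : Touches L x ⊎ (y ≡ x × b ≡ b₀)

    record Chain : Set where
      field
        edges       : List Edge
        terminus    : Vertex
        bichromatic : ∀ {f} → f ∈ edges → Bichromatic f
        closed      : Closed edges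
        ends        : ∀ z b → Touches edges z → Missing φ z (colour b) → z ≡ x ⊎ z ≡ terminus
        started     : Missing φ x (colour b₀) ⊎ Touches edges x
        minimal     : ∀ K → Closed K → Touches K x → edges ⊆ K
        reachable   : ∀ Hs → edges ⊆ Hs → ∀ {f} → f ∈ edges → Reach G (spannedBy Hs) x (end₁ f)

    empty : Walk [] x b₀
    empty = record
      { bichromatic  = λ ()
      ; closed-off-y = λ _ _ ()
      ; entered      = λ h h∼x h-c → ⊥-elim (x-missing (h , h∼x , h-c))
      ; fresh        = λ _ _ _ ()
      ; interior     = λ { z (_ , () , _) }
      ; entry        = inj₁ refl
      ; minimal      = λ _ _ _ ()
      ; reachable    = λ _ _ → here , λ ()
      ; started      = inj₂ (refl , refl) }

    stop : ∀ {L y b} → Walk L y b → Missing φ y (colour b) → Chain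
    stop {L} {y} {b} walk b∉y = record
      { edges = L ; terminus = y ; bichromatic = bichromatic ; closed = closed-L ; ends = ends
      ; started = [ inj₂ , (λ { (y≡x , b≡b₀) → inj₁ (subst₂ (λ z c → Missing φ z (colour c)) y≡x b≡b₀ b∉y) }) ]′ started
      ; minimal = minimal
      ; reachable = λ Hs L⊆Hs → proj₂ (reachable Hs L⊆Hs) }
      where
      open Walk walk
      closed-L : Closed L
      closed-L z {f} {g} f∈L f∼z g∼z g-βγ with z ≟ y
      ... | no z≢y  = closed-off-y z z≢y f∈L f∼z g∼z g-βγ
      ... | yes refl with bichromatic-split b g-βγ
      ...   | inj₁ g-b  = ⊥-elim (b∉y (g , g∼z , g-b))
      ...   | inj₂ g-b′ = entered g g∼z g-b′
      ends : ∀ z b′ → Touches L z → Missing φ z (colour b′) → z ≡ x ⊎ z ≡ y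
      ends z b′ touched b′∉z with z ≟ y | z ≟ x
      ... | yes z≡y | _       = inj₂ z≡y
      ... | no _    | yes z≡x = inj₁ z≡x
      ... | no z≢y  | no z≢x  = ⊥-elim (b′∉z (present b′ (interior z touched z≢y z≢x)))
        where
        present : ∀ b′ → Present φ z β × Present φ z γ → Present φ z (colour b′)
        present true  = proj₁
        present false = proj₂

    advance : ∀ {L y b} → Walk L y b → ∀ g → Incident G g y → φ g ≡ just (colour b) →
              (y′ : OtherEnd g y) → Walk (g ∷ L) (OtherEnd.vertex y′) (not b)
    advance {L} {y} {b} walk g g∼y g-b y′ = record
      { bichromatic = bichromatic′ ; closed-off-y = closed-off-y′ ; entered = entered′ ; fresh = fresh′
      ; interior = interior′ ; entry = entry′ ; minimal = minimal′ ; reachable = reachable′ ; started = started′ }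
      where
      open Walk walk
      open OtherEnd y′ renaming (vertex to y₁; incident to g∼y₁)
      g-bichromatic : Bichromatic g
      g-bichromatic = colour⇒bichromatic b g-b
      bichromatic′ : ∀ {f} → f ∈ g ∷ L → Bichromatic f
      bichromatic′ (here refl) = g-bichromatic
      bichromatic′ (there f∈L) = bichromatic f∈L
      closed-off-y′ : ∀ z {f h} → z ≢ y₁ → f ∈ g ∷ L → Incident G f z → Incident G h z → Bichromatic h → h ∈ g ∷ L
      closed-off-y′ z z≢y₁ f∈ f∼z h∼z h-βγ with z ≟ y
      closed-off-y′ z z≢y₁ f∈ f∼z h∼z h-βγ | yes refl with bichromatic-split b h-βγ
      ... | inj₁ h-b  = here (proper⇒unique proper h∼z g∼y h-b g-b)
      ... | inj₂ h-b′ = there (entered _ h∼z h-b′)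
      closed-off-y′ z z≢y₁ (here refl) f∼z h∼z h-βγ | no z≢y =
        [ ⊥-elim ∘ z≢y , ⊥-elim ∘ z≢y₁ ]′ (only z f∼z)
      closed-off-y′ z z≢y₁ (there f∈L) f∼z h∼z h-βγ | no z≢y = there (closed-off-y z z≢y f∈L f∼z h∼z h-βγ)
      entered′ : ∀ h → Incident G h y₁ → φ h ≡ just (colour (not (not b))) → h ∈ g ∷ L
      entered′ h h∼y₁ h-b = here (proper⇒unique proper h∼y₁ g∼y₁ (trans h-b (cong (just ∘ colour) (not-involutive b))) g-b)
      fresh′ : ∀ h → Incident G h y₁ → φ h ≡ just (colour (not b)) → h ∉ g ∷ L
      fresh′ h h∼y₁ h-b′ (here refl) = colour-not b (just-injective (trans (sym g-b) h-b′))
      fresh′ h h∼y₁ h-b′ (there h∈L) = fresh g g∼y g-b (closed-off-y y₁ distinct h∈L h∼y₁ g∼y₁ g-bichromatic)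
      interior′ : ∀ z → Touches (g ∷ L) z → z ≢ y₁ → z ≢ x → Present φ z β × Present φ z γ
      interior′ z touched z≢y₁ z≢x with z ≟ y
      interior′ z touched z≢y₁ z≢x | yes refl with entry
      ... | inj₁ z≡x                  = ⊥-elim (z≢x z≡x)
      ... | inj₂ (h , _ , h∼z , h-b′) = present-both b (g , g∼y , g-b) (h , h∼z , h-b′)
      interior′ z (f , here refl , f∼z) z≢y₁ z≢x | no z≢y = [ ⊥-elim ∘ z≢y , ⊥-elim ∘ z≢y₁ ]′ (only z f∼z)
      interior′ z (f , there f∈L , f∼z) z≢y₁ z≢x | no z≢y = interior z (f , f∈L , f∼z) z≢y z≢x
      entry′ : y₁ ≡ x ⊎ ∃[ h ] (h ∈ g ∷ L × Incident G h y₁ × φ h ≡ just (colour (not (not b))))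
      entry′ = inj₂ (g , here refl , g∼y₁ , trans g-b (cong (just ∘ colour) (sym (not-involutive b))))
      minimal′ : ∀ K → Closed K → Touches K x → g ∷ L ⊆ K
      minimal′ K closed-K touches-x (there f∈L) = minimal K closed-K touches-x f∈L
      minimal′ K closed-K touches-x (here refl) with entry
      ... | inj₁ refl             = closed-K y (proj₁ (proj₂ touches-x)) (proj₂ (proj₂ touches-x)) g∼y g-bichromatic
      ... | inj₂ (h , h∈L , h∼y , _) = closed-K y (minimal K closed-K touches-x h∈L) h∼y g∼y g-bichromatic
      reachable′ : ∀ Hs → g ∷ L ⊆ Hs →
                   Reach G (spannedBy Hs) x y₁ × (∀ {f} → f ∈ g ∷ L → Reach G (spannedBy Hs) x (end₁ f))
      reachable′ Hs g∷L⊆Hs = x⇝y₁ , x⇝f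
        where
        x⇝y : Reach G (spannedBy Hs) x y × (∀ {f} → f ∈ L → Reach G (spannedBy Hs) x (end₁ f))
        x⇝y = reachable Hs (λ f∈L → g∷L⊆Hs (there f∈L))
        x⇝y₁ : Reach G (spannedBy Hs) x y₁
        x⇝y₁ = Reach-snoc (proj₁ x⇝y) g (∈⇒spanned (g∷L⊆Hs (here refl))) joins
        x⇝f : ∀ {f} → f ∈ g ∷ L → Reach G (spannedBy Hs) x (end₁ f)
        x⇝f (there f∈L) = proj₂ x⇝y f∈L
        x⇝f (here refl) = [ (λ end≡y → subst (Reach G _ x) (sym end≡y) (proj₁ x⇝y))
                          , (λ end≡y₁ → subst (Reach G _ x) (sym end≡y₁) x⇝y₁) ]′ (only (end₁ g) (inj₁ refl))
      started′ : Touches (g ∷ L) x ⊎ (y₁ ≡ x × not b ≡ b₀)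
      started′ with started
      ... | inj₁ (f , f∈L , f∼x) = inj₁ (f , there f∈L , f∼x)
      ... | inj₂ (refl , _)      = inj₁ (g , here refl , g∼y)

    -- Each step adds an unvisited edge, so the walk stops within unvisited [] steps.
    follow : ∀ fuel {L y b} → unvisited L < fuel → Walk L y b → Chain
    follow zero () _
    follow (suc fuel) {L} {y} {b} bound walk with present? φ y (colour b)
    ... | no b∉y               = stop walk b∉y
    ... | yes (g , g∼y , g-b) =
      follow fuel (≤-trans (unvisited-∷ (Walk.fresh walk g g∼y g-b)) (s≤s⁻¹ bound))
        (advance walk g g∼y g-b (otherEnd loopless g y g∼y))

    chain : Chain
    chain = follow (suc (unvisited [])) ≤-refl empty

  module Swap (L : List Edge) (bichromatic : ∀ {f} → f ∈ L → Bichromatic f) (closed : Closed L) where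

    interchange : Fin r → Fin r
    interchange c with c ≟ β
    ... | yes _ = γ
    ... | no _  = β

    interchange-colour : ∀ b → interchange (colour b) ≡ colour (not b)
    interchange-colour true with β ≟ β
    ... | yes _  = refl
    ... | no β≢β = ⊥-elim (β≢β refl)
    interchange-colour false with γ ≟ β
    ... | yes γ≡β = ⊥-elim (β≢γ (sym γ≡β))
    ... | no _    = refl

    swapped : Colouring
    swapped g with g ∈? L
    ... | yes _ = Maybe.map interchange (φ g)
    ... | no _  = φ g

    swapped-outside : ∀ g → g ∉ L → swapped g ≡ φ g
    swapped-outside g g∉L with g ∈? L
    ... | yes g∈L = ⊥-elim (g∉L g∈L)
    ... | no _    = refl

    swapped-inside : ∀ g → g ∈ L → ∀ b → φ g ≡ just (colour b) → swapped g ≡ just (colour (not b))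
    swapped-inside g g∈L b g-b with g ∈? L
    ... | no g∉L = ⊥-elim (g∉L g∈L)
    ... | yes _ rewrite g-b = cong just (interchange-colour b)

    swapped-value : ∀ g → g ∈ L → ∀ c → swapped g ≡ just c → ∃[ b ] (φ g ≡ just (colour b) × c ≡ colour (not b))
    swapped-value g g∈L c g-c with bichromatic-split true (bichromatic g∈L)
    ... | inj₁ g-β = true  , g-β , just-injective (trans (sym g-c) (swapped-inside g g∈L true g-β))
    ... | inj₂ g-γ = false , g-γ , just-injective (trans (sym g-c) (swapped-inside g g∈L false g-γ))

    ∈-or-∉ : ∀ g → g ∈ L ⊎ g ∉ L
    ∈-or-∉ g with g ∈? L
    ... | yes g∈L = inj₁ g∈L
    ... | no g∉L  = inj₂ g∉L

    swapped-proper : Proper G r swapped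
    swapped-proper f g f≢g (z , f∼z , g∼z) c f-c g-c with ∈-or-∉ f | ∈-or-∉ g
    ... | inj₂ f∉L | inj₂ g∉L =
      proper f g f≢g (z , f∼z , g∼z) c (trans (sym (swapped-outside f f∉L)) f-c) (trans (sym (swapped-outside g g∉L)) g-c)
    ... | inj₁ f∈L | inj₁ g∈L with swapped-value f f∈L c f-c | swapped-value g g∈L c g-c
    ...   | b , f-b , c≡b′ | b′ , g-b′ , c≡b′′ =
      proper f g f≢g (z , f∼z , g∼z) (colour b) f-b
        (trans g-b′ (cong just (sym (colour-not-injective b b′ (trans (sym c≡b′) c≡b′′)))))
    swapped-proper f g f≢g (z , f∼z , g∼z) c f-c g-c | inj₁ f∈L | inj₂ g∉L with swapped-value f f∈L c f-c
    ... | b , _ , c≡b′ =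
      g∉L (closed z f∈L f∼z g∼z (colour⇒bichromatic (not b) (trans (trans (sym (swapped-outside g g∉L)) g-c) (cong just c≡b′))))
    swapped-proper f g f≢g (z , f∼z , g∼z) c f-c g-c | inj₂ f∉L | inj₁ g∈L with swapped-value g g∈L c g-c
    ... | b , _ , c≡b′ =
      f∉L (closed z g∈L g∼z f∼z (colour⇒bichromatic (not b) (trans (trans (sym (swapped-outside f f∉L)) f-c) (cong just c≡b′))))

    swapped-sameDomain : SameDomain φ swapped
    swapped-sameDomain g with g ∈? L
    ... | no _ = ⇔.refl
    ... | yes _ with φ g
    ...   | just _  = mk⇔ (λ _ → is-just tt) (λ _ → is-just tt)
    ...   | nothing = ⇔.refl

    swapped-missing-touched : ∀ {z} b → Touches L z → Missing φ z (colour b) → Missing swapped z (colour (not b))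
    swapped-missing-touched {z} b (f , f∈L , f∼z) b∉z (g , g∼z , g-b′) with ∈-or-∉ g
    ... | inj₂ g∉L = g∉L (closed z f∈L f∼z g∼z (colour⇒bichromatic (not b) (trans (sym (swapped-outside g g∉L)) g-b′)))
    ... | inj₁ g∈L with swapped-value g g∈L _ g-b′
    ...   | b′ , g-b″ , b′≡b″ = b∉z (g , g∼z , trans g-b″ (cong just (colour-not-injective b′ b (sym b′≡b″))))

    swapped-missing-untouched : ∀ {z d} → ¬ Touches L z → Missing φ z d → Missing swapped z d
    swapped-missing-untouched {z} untouched d∉z (g , g∼z , g-d) with ∈-or-∉ g
    ... | inj₁ g∈L = untouched (g , g∈L , g∼z)
    ... | inj₂ g∉L = d∉z (g , g∼z , trans (sym (swapped-outside g g∉L)) g-d)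

    swapped-missing-other : ∀ {z d} → d ≢ β → d ≢ γ → Missing φ z d → Missing swapped z d
    swapped-missing-other {z} {d} d≢β d≢γ d∉z (g , g∼z , g-d) with ∈-or-∉ g
    ... | inj₂ g∉L = d∉z (g , g∼z , trans (sym (swapped-outside g g∉L)) g-d)
    ... | inj₁ g∈L with swapped-value g g∈L _ g-d
    ...   | true  , _ , d≡γ = d≢γ d≡γ
    ...   | false , _ , d≡β = d≢β d≡β

-- Counting present colours

module PresentColours (G : Multigraph) (r : ℕ) (φ : PartialColoring G r) where
  open Edges G
  open Colourings G r

  presentCount : Vertex → ℕ
  presentCount z = sum (λ c → 𝟙 (present? φ z c))

  colouredWith : ∀ z g c → Dec (Incident G g z × φ g ≡ just c)
  colouredWith z g c = incident? G z g ×-dec Maybe.≡-dec _≟_ (φ g) (just c)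

  colouredAt : Vertex → Edge → ℕ
  colouredAt z g = sum (λ c → 𝟙 (colouredWith z g c))

  deg≡∑incident : ∀ z → deg G z ≡ sum (λ g → 𝟙 (incident? G z g))
  deg≡∑incident z = length-filter-tabulate (incident? G z) id

  presentCount≤∑colouredAt : ∀ z → presentCount z ≤ sum (colouredAt z)
  presentCount≤∑colouredAt z = ≤-trans (sum-mono-≤ present≤) (≤-reflexive (∑-comm (λ c g → 𝟙 (colouredWith z g c))))
    where
    present≤ : ∀ c → 𝟙 (present? φ z c) ≤ sum (λ g → 𝟙 (colouredWith z g c))
    present≤ c with present? φ z c
    ... | no _                = z≤n
    ... | yes (g , g∼z , g-c) =
      ≤-trans (≤-reflexive (sym (𝟙-yes (colouredWith z g c) (g∼z , g-c)))) (term≤sum (λ g → 𝟙 (colouredWith z g c)) g)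

  colouredAt≤incident : ∀ z g → colouredAt z g ≤ 𝟙 (incident? G z g)
  colouredAt≤incident z g = at-most-one-colour (incident? G z g)
    where
    at-most-one-colour : ∀ {A : Set} (a? : Dec A) → sum (λ c → 𝟙 (a? ×-dec Maybe.≡-dec _≟_ (φ g) (just c))) ≤ 𝟙 a?
    at-most-one-colour (no ¬a) = ≤-reflexive (sum-zero λ c → 𝟙-no (no ¬a ×-dec Maybe.≡-dec _≟_ (φ g) (just c)) (¬a ∘ proj₁))
    at-most-one-colour (yes a) = ∑𝟙-atMostOne (λ c → yes a ×-dec Maybe.≡-dec _≟_ (φ g) (just c))
      λ c d g-c g-d → just-injective (trans (sym (proj₂ g-c)) (proj₂ g-d))

  colouredAt-uncoloured : ∀ z g → φ g ≡ nothing → colouredAt z g ≡ 0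
  colouredAt-uncoloured z g g-blank = sum-zero λ c → 𝟙-no (colouredWith z g c) λ { (_ , g-c) → nothing≢just (trans (sym g-blank) g-c) }
    where
    nothing≢just : ∀ {c : Fin r} → nothing ≢ just c
    nothing≢just ()

  presentCount≤deg : ∀ z → presentCount z ≤ deg G z
  presentCount≤deg z = begin
    presentCount z                       ≤⟨ presentCount≤∑colouredAt z ⟩
    sum (colouredAt z)                   ≤⟨ sum-mono-≤ (colouredAt≤incident z) ⟩
    sum (λ g → 𝟙 (incident? G z g))      ≡⟨ deg≡∑incident z ⟨
    deg G z                              ∎
    where open Data.Nat.Properties.≤-Reasoning

  presentCount<deg : ∀ z e → Incident G e z → φ e ≡ nothing → presentCount z < deg G z
  presentCount<deg z e e∼z e-blank = begin
    suc (presentCount z)                              ≡⟨ +-comm 1 (presentCount z) ⟩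
    presentCount z + 1                                ≤⟨ +-mono-≤ (presentCount≤∑colouredAt z) e-counted ⟩
    sum (colouredAt z) + sum isE                      ≡⟨ ∑-distrib-+ (colouredAt z) isE ⟨
    sum (λ g → colouredAt z g + isE g)                ≤⟨ sum-mono-≤ bound ⟩
    sum (λ g → 𝟙 (incident? G z g))                   ≡⟨ deg≡∑incident z ⟨
    deg G z                                           ∎
    where
    open Data.Nat.Properties.≤-Reasoning
    isE : Edge → ℕ
    isE g = 𝟙 (g ≟ e)
    e-counted : 1 ≤ sum isE
    e-counted = ≤-trans (≤-reflexive (sym (𝟙-yes (e ≟ e) refl))) (term≤sum isE e)
    bound : ∀ g → colouredAt z g + 𝟙 (g ≟ e) ≤ 𝟙 (incident? G z g)
    bound g with g ≟ e
    ... | yes refl rewrite colouredAt-uncoloured z g e-blank | 𝟙-yes (incident? G z g) e∼z = ≤-refl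
    ... | no _     = ≤-trans (≤-reflexive (+-identityʳ _)) (colouredAt≤incident z g)

  nothing-missing⇒r≤presentCount : ∀ z → (∀ c → ¬ Missing φ z c) → r ≤ presentCount z
  nothing-missing⇒r≤presentCount z none = begin
    r                  ≡⟨ trans (sum-const r 1) (*-identityʳ r) ⟨
    sum {r} (λ _ → 1)  ≤⟨ sum-mono-≤ (λ c → ≤-reflexive (sym (𝟙-yes (present? φ z c) (¬missing⇒present (none c))))) ⟩
    presentCount z     ∎
    where open Data.Nat.Properties.≤-Reasoning

  -- Every colour is present at two of the three vertices.
  no-common-missing⇒2r≤ : ∀ a b d → ¬ CommonMissing φ a b → ¬ CommonMissing φ b d → ¬ CommonMissing φ a d →
                          r * 2 ≤ presentCount a + presentCount b + presentCount d
  no-common-missing⇒2r≤ a b d ab bd ad = begin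
    r * 2                                               ≡⟨ sum-const r 2 ⟨
    sum {r} (λ _ → 2)                                   ≤⟨ sum-mono-≤ two-present ⟩
    sum (λ c → 𝟙 (present? φ a c) + 𝟙 (present? φ b c) + 𝟙 (present? φ d c))
      ≡⟨ ∑-distrib-+ (λ c → 𝟙 (present? φ a c) + 𝟙 (present? φ b c)) (λ c → 𝟙 (present? φ d c)) ⟩
    sum (λ c → 𝟙 (present? φ a c) + 𝟙 (present? φ b c)) + presentCount d
      ≡⟨ cong (_+ presentCount d) (∑-distrib-+ (λ c → 𝟙 (present? φ a c)) (λ c → 𝟙 (present? φ b c))) ⟩
    presentCount a + presentCount b + presentCount d    ∎
    where
    open Data.Nat.Properties.≤-Reasoning
    two-present : ∀ c → 2 ≤ 𝟙 (present? φ a c) + 𝟙 (present? φ b c) + 𝟙 (present? φ d c)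
    two-present c with present? φ a c | present? φ b c | present? φ d c
    ... | yes _   | yes _   | _       = s≤s (s≤s z≤n)
    ... | yes _   | no _    | yes _   = s≤s (s≤s z≤n)
    ... | no _    | yes _   | yes _   = s≤s (s≤s z≤n)
    ... | no c∉a  | no c∉b  | _       = ⊥-elim (ab (c , c∉a , c∉b))
    ... | no c∉a  | yes _   | no c∉d  = ⊥-elim (ad (c , c∉a , c∉d))
    ... | yes _   | no c∉b  | no c∉d  = ⊥-elim (bd (c , c∉b , c∉d))

3Δ≤1+⌊3Δ/2⌋*2 : ∀ Δ → 3 * Δ ≤ 1 + (3 * Δ / 2) * 2
3Δ≤1+⌊3Δ/2⌋*2 Δ = begin
  3 * Δ                              ≡⟨ m≡m%n+[m/n]*n (3 * Δ) 2 ⟩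
  3 * Δ % 2 + (3 * Δ / 2) * 2        ≤⟨ +-monoˡ-≤ _ (s≤s⁻¹ (m%n<n (3 * Δ) 2)) ⟩
  1 + (3 * Δ / 2) * 2                ∎
  where open Data.Nat.Properties.≤-Reasoning

3Δ≤1+2r⇒Δ≤r : ∀ {Δ r} → 3 * Δ ≤ 1 + r * 2 → Δ ≤ r
3Δ≤1+2r⇒Δ≤r {Δ} {r} 3Δ≤1+2r = ≮⇒≥ λ r<Δ → <⇒≱ (begin-strict
  1 + r * 2       <⟨ n<1+n _ ⟩
  suc r * 2       ≤⟨ *-monoˡ-≤ 2 r<Δ ⟩
  Δ * 2           ≡⟨ *-comm Δ 2 ⟩
  2 * Δ           ≤⟨ *-monoˡ-≤ Δ {2} {3} (s≤s (s≤s z≤n)) ⟩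
  3 * Δ           ∎) 3Δ≤1+2r
  where open Data.Nat.Properties.≤-Reasoning

3Δ≤1+2r⇒¬2r≤ : ∀ {Δ r a b d} → 3 * Δ ≤ 1 + r * 2 → a < Δ → b < Δ → d ≤ Δ → ¬ r * 2 ≤ a + b + d
3Δ≤1+2r⇒¬2r≤ {Δ} {r} {a} {b} {d} 3Δ≤1+2r a<Δ b<Δ d≤Δ 2r≤a+b+d = <⇒≱ (begin-strict
  1 + r * 2                ≤⟨ +-monoʳ-≤ 1 2r≤a+b+d ⟩
  1 + (a + b + d)          <⟨ s≤s (≤-reflexive (cong (_+ d) (sym (+-suc a b)))) ⟩
  suc a + suc b + d        ≤⟨ +-mono-≤ (+-mono-≤ a<Δ b<Δ) d≤Δ ⟩
  Δ + Δ + Δ                ≡⟨ trans (+-assoc Δ Δ Δ) (cong (λ x → Δ + (Δ + x)) (sym (+-identityʳ Δ))) ⟩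
  3 * Δ                    ∎) 3Δ≤1+2r
  where open Data.Nat.Properties.≤-Reasoning

-- Augmenting subgraphs

module Augmentation (G : Multigraph) (loopless : Loopless G) (Δ r : ℕ) (r-large : 3 * Δ ≤ 1 + r * 2)
                    (deg≤Δ : ∀ z → deg G z ≤ Δ) (φ : PartialColoring G r) (proper : Proper G r φ)
                    (e : Fin (m G)) (e-blank : φ e ≡ nothing) where
  open Edges G
  open Colourings G r
  open PresentColours G r φ

  u v : Vertex
  u = end₁ e
  v = end₂ e

  AugmentingSubgraph : Set
  AugmentingSubgraph = ∃[ H ] (Connected G H × EAugmenting G r φ e H)

  augment : (L : List Edge) → e ∈ L → (∀ {f} → f ∈ L → Reach G (spannedBy L) u (end₁ f)) →
            (ψ : Colouring) → Proper G r ψ → SameDomain φ ψ → (∀ f → f ∉ L → ψ f ≡ φ f) →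
            (c : Fin r) → Missing ψ u c → Missing ψ v c → AugmentingSubgraph
  augment L e∈L reach ψ ψ-proper same ψ-outside c c∉u c∉v =
    spannedBy L , spannedBy-connected e∈L reach ,
    recolour ψ e c , recolour-proper ψ-proper e c (missing-at-ends c∉u c∉v) , recolour-extends φ ψ e c same ,
    λ f f∉H → trans (recolour-≢ ψ e c f λ { refl → f∉H (∈⇒spanned e∈L) }) (ψ-outside f (f∉H ∘ ∈⇒spanned))

  some-missing : ∀ z → Incident G e z → ∃[ c ] Missing φ z c
  some-missing z e∼z = decidable-stable (Fin.any? (missing? φ z)) λ none →
    <⇒≱ (<-≤-trans (presentCount<deg z e e∼z e-blank) (deg≤Δ z))
        (≤-trans (3Δ≤1+2r⇒Δ≤r {Δ} {r} r-large) (nothing-missing⇒r≤presentCount z λ c c∉z → none (c , c∉z)))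

  module Fan (uv-disjoint : ¬ CommonMissing φ u v) (α : Fin r) (α∉u : Missing φ u α)
             (f : Edge) (f∼v : Incident G f v) (f-α : φ f ≡ just α) where

    open OtherEnd (otherEnd loopless f v f∼v) renaming (vertex to w; incident to f∼w; distinct to w≢v)

    f≁u : ¬ Incident G f u
    f≁u f∼u = α∉u (f , f∼u , f-α)

    u⇝v : ∀ {L} → e ∈ L → Reach G (spannedBy L) u v
    u⇝v e∈L = step e (∈⇒spanned e∈L) (inj₁ refl) here

    u⇝w : ∀ {L} → e ∈ L → f ∈ L → Reach G (spannedBy L) u w
    u⇝w e∈L f∈L = Reach-snoc (u⇝v e∈L) f (∈⇒spanned f∈L) joins

    u⇝f : ∀ {L} → e ∈ L → f ∈ L → Reach G (spannedBy L) u (end₁ f)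
    u⇝f e∈L f∈L = [ (λ p → subst (Reach G _ u) (sym p) (u⇝v e∈L))
                  , (λ p → subst (Reach G _ u) (sym p) (u⇝w e∈L f∈L)) ]′ (only (end₁ f) (inj₁ refl))

    -- Moving f to a colour c missing at v and w frees α at v.
    shift-f : (ψ : Colouring) → Proper G r ψ → SameDomain φ ψ → ψ f ≡ just α → Missing ψ u α →
              (c : Fin r) → Missing ψ v c → Missing ψ w c →
              (L : List Edge) → e ∈ L → f ∈ L → (∀ {g} → g ∈ L → Reach G (spannedBy L) u (end₁ g)) →
              (∀ g → g ∉ L → ψ g ≡ φ g) → AugmentingSubgraph
    shift-f ψ ψ-proper same ψf-α α∉u′ c c∉v c∉w L e∈L f∈L reach ψ-outside =
      augment L e∈L reach (recolour ψ f c)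
        (recolour-proper ψ-proper f c c-missing-at)
        (λ g → ⇔.trans (same g) (recolour-sameDomain ψ f c (subst Is-just (sym ψf-α) (is-just tt)) g))
        (λ g g∉L → trans (recolour-≢ ψ f c g λ { refl → g∉L f∈L }) (ψ-outside g g∉L))
        α (recolour-missing f c α∉u′ (⊥-elim ∘ f≁u))
        (recolour-frees f c (λ g g∼v g-α → proper⇒unique ψ-proper g∼v f∼v g-α ψf-α) c≢α)
      where
      c-missing-at : ∀ {z} → Incident G f z → Missing ψ z c
      c-missing-at {z} f∼z = [ (λ { refl → c∉v }) , (λ { refl → c∉w }) ]′ (only z f∼z)
      c≢α : c ≢ α
      c≢α refl = c∉v (f , f∼v , ψf-α)

    vw-common : CommonMissing φ v w → AugmentingSubgraph
    vw-common (c , c∉v , c∉w) = shift-f φ proper (λ _ → ⇔.refl) f-α α∉u c c∉v c∉w (e ∷ f ∷ []) (here refl) (there (here refl))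
      (λ { (here refl) → here ; (there (here refl)) → u⇝f (here refl) (there (here refl)) })
      (λ _ _ → refl)

    uw-common : ¬ CommonMissing φ v w → CommonMissing φ u w
    uw-common vw-disjoint = decidable-stable (commonMissing? φ u w) λ uw-disjoint →
      3Δ≤1+2r⇒¬2r≤ {Δ} {r} r-large (<-≤-trans (presentCount<deg u e (inj₁ refl) e-blank) (deg≤Δ u))
                                   (<-≤-trans (presentCount<deg v e (inj₂ refl) e-blank) (deg≤Δ v))
                                   (≤-trans (presentCount≤deg w) (deg≤Δ w))
        (no-common-missing⇒2r≤ u v w uv-disjoint vw-disjoint uw-disjoint)

    module Kempe (β : Fin r) (β∉v : Missing φ v β) (γ : Fin r) (γ∉u : Missing φ u γ) (γ∉w : Missing φ w γ) where

      γ∈v : ¬ Missing φ v γ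
      γ∈v γ∉v = uv-disjoint (γ , γ∉u , γ∉v)

      β≢γ : β ≢ γ
      β≢γ β≡γ = γ∈v (subst (Missing φ v) β≡γ β∉v)

      open KempeChains G r loopless φ proper β γ β≢γ
      module Pv = From.Chain (From.chain v false β∉v)
      module Pw = From.Chain (From.chain w true γ∉w)

      swap-at-v : ¬ Touches Pv.edges u → AugmentingSubgraph
      swap-at-v u∉Pv = augment (e ∷ Pv.edges) (here refl) reach S.swapped S.swapped-proper S.swapped-sameDomain
        (λ g g∉ → S.swapped-outside g (g∉ ∘ there)) γ
        (S.swapped-missing-untouched u∉Pv γ∉u)
        (S.swapped-missing-touched true ([ ⊥-elim ∘ γ∈v , id ]′ Pv.started) β∉v)
        where
        module S = Swap Pv.edges Pv.bichromatic Pv.closed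
        reach : ∀ {g} → g ∈ e ∷ Pv.edges → Reach G (spannedBy (e ∷ Pv.edges)) u (end₁ g)
        reach (here refl) = here
        reach (there g∈Pv) = Reach-trans (u⇝v (here refl)) (Pv.reachable (e ∷ Pv.edges) there g∈Pv)

      -- Pv ⊆ Pw would make u and v two ends of Pw distinct from its start w.
      Pw-avoids-v : Touches Pv.edges u → ¬ Touches Pw.edges v
      Pw-avoids-v (g , g∈Pv , g∼u) v∈Pw with Pw.ends u false (g , Pv.minimal Pw.edges Pw.closed v∈Pw g∈Pv , g∼u) γ∉u
                                           | Pw.ends v true v∈Pw β∉v
      ... | inj₁ u≡w | _        = f≁u (subst (Incident G f) (sym u≡w) f∼w)
      ... | inj₂ _   | inj₁ v≡w = w≢v (sym v≡w)
      ... | inj₂ u≡t | inj₂ v≡t = loopless e (trans u≡t (sym v≡t))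

      swap-at-w : ¬ Touches Pw.edges v → AugmentingSubgraph
      swap-at-w v∉Pw = shift-f S.swapped S.swapped-proper S.swapped-sameDomain ψf-α
        (S.swapped-missing-other α≢β α≢γ α∉u) β (S.swapped-missing-untouched v∉Pw β∉v) β∉w
        (e ∷ f ∷ Pw.edges) (here refl) (there (here refl)) reach
        (λ g g∉ → S.swapped-outside g (g∉ ∘ there ∘ there))
        where
        module S = Swap Pw.edges Pw.bichromatic Pw.closed
        α≢β : α ≢ β
        α≢β α≡β = β∉v (f , f∼v , trans f-α (cong just α≡β))
        α≢γ : α ≢ γ
        α≢γ α≡γ = γ∉w (f , f∼w , trans f-α (cong just α≡γ))
        f∉Pw : f ∉ Pw.edges
        f∉Pw f∈Pw = [ α≢β ∘ just-injective ∘ trans (sym f-α) , α≢γ ∘ just-injective ∘ trans (sym f-α) ]′ (Pw.bichromatic f∈Pw)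
        ψf-α : S.swapped f ≡ just α
        ψf-α = trans (S.swapped-outside f f∉Pw) f-α
        β∉w : Missing S.swapped w β
        β∉w with touches? Pw.edges w
        ... | yes w∈Pw = S.swapped-missing-touched false w∈Pw γ∉w
        ... | no w∉Pw  = [ S.swapped-missing-untouched w∉Pw , ⊥-elim ∘ w∉Pw ]′ Pw.started
        reach : ∀ {g} → g ∈ e ∷ f ∷ Pw.edges → Reach G (spannedBy (e ∷ f ∷ Pw.edges)) u (end₁ g)
        reach (here refl)           = here
        reach (there (here refl))   = u⇝f (here refl) (there (here refl))
        reach (there (there g∈Pw)) = Reach-trans (u⇝w (here refl) (there (here refl))) (Pw.reachable _ (there ∘ there) g∈Pw)

      kempe : AugmentingSubgraph
      kempe with touches? Pv.edges u
      ... | no u∉Pv  = swap-at-v u∉Pv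
      ... | yes u∈Pv = swap-at-w (Pw-avoids-v u∈Pv)

    fan : AugmentingSubgraph
    fan with commonMissing? φ v w
    ... | yes vw = vw-common vw
    ... | no vw-disjoint with uw-common vw-disjoint | some-missing v (inj₂ refl)
    ...   | γ , γ∉u , γ∉w | β , β∉v = Kempe.kempe β β∉v γ γ∉u γ∉w

  augmentingSubgraph : AugmentingSubgraph
  augmentingSubgraph with commonMissing? φ u v
  ... | yes (c , c∉u , c∉v) = augment (e ∷ []) (here refl) (λ { (here refl) → here }) φ proper (λ _ → ⇔.refl) (λ _ _ → refl) c c∉u c∉v
  ... | no uv-disjoint with some-missing u (inj₁ refl)
  ...   | α , α∉u with ¬missing⇒present (λ α∉v → uv-disjoint (α , α∉u , α∉v))
  ...     | f , f∼v , f-α = Fan.fan uv-disjoint α α∉u f f∼v f-α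

corollary2p13 : (G : Multigraph) → Loopless G → (Δ : ℕ) → MaxDegree G Δ → 2 ≤ Δ →
    (φ : PartialColoring G ((3 * Δ) / 2)) → Proper G ((3 * Δ) / 2) φ →
    (e : Fin (m G)) → φ e ≡ nothing →
    ∃[ H ] (Connected G H × EAugmenting G ((3 * Δ) / 2) φ e H)
corollary2p13 G loopless Δ (deg≤Δ , _) _ φ proper e e-blank =
  Augmentation.augmentingSubgraph G loopless Δ (3 * Δ / 2) (3Δ≤1+⌊3Δ/2⌋*2 Δ) deg≤Δ φ proper e e-blank
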